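{- Define the relation $\succ^g$ on $\mathcal{EL}$ axioms by $\beta\succ^g\gamma$ iff $\mathit{Con}(\{\gamma\})\subsetneq\mathit{Con}(\{\beta\})$. Then $\succ^g$ is a weakening relation on $\mathcal{EL}$ axioms that is not one-step generated.
   Context: $\mathcal{EL}$ concepts: $C::=A\mid\top\mid C\sqcap C\mid\exists r.C$ ($A$ concept name, $r$ role name); $\mathcal{EL}$ axioms are GCIs $C\sqsubseteq D$, concept assertions $C(a)$ and role assertions $r(a,b)$, interpreted in interpretations $\mathcal{I}$ with $\top^\mathcal{I}=\Delta^\mathcal{I}$, $(C\sqcap D)^\mathcal{I}=C^\mathcal{I}\cap D^\mathcal{I}$, $(\exists r.C)^\mathcal{I}=\{d\mid\exists e\in C^\mathcal{I},(d,e)\in r^\mathcal{I}\}$; $\mathcal{I}$ satisfies $C\sqsubseteq D$ iff $C^\mathcal{I}\subseteq D^\mathcal{I}$, $C(a)$ iff $a^\mathcal{I}\in C^\mathcal{I}$, $r(a,b)$ iff $(a^\mathcal{I},b^\mathcal{I})\in r^\mathcal{I}$. $\mathfrak{O}\models\alpha$ iff every model of the finite axiom set $\mathfrak{O}$ satisfies $\alpha$; $\mathit{Con}(\mathfrak{O})=\{\alpha\mid\mathfrak{O}\models\alpha\}$. A pre-order is an irreflexive, transitive relation; a pre-order $\succ$ on axioms is a weakening relation if $\beta\succ\gamma$ implies $\mathit{Con}(\{\gamma\})\subsetneq\mathit{Con}(\{\beta\})$. Its one-step relation is $\succ_1=\{(\beta,\gamma)\in\succ\mid$ no $\delta$ with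 $\beta\succ\delta\succ\gamma\}$, and $\succ$ is one-step generated if the transitive closure of $\succ_1$ equals $\succ$. -}

module Defs where

open import Level using (Level; _⊔_) renaming (suc to lsuc; zero to lzero)
open import Data.Nat using (ℕ)
open import Data.Unit using () renaming (⊤ to Unit)
open import Data.Product using (Σ; _×_; ∃; ∃-syntax; _,_)
open import Relation.Nullary using (¬_)
open import Relation.Binary.Core using (Rel)
open import Relation.Binary.Definitions using (Irreflexive; Transitive)
open import Relation.Binary.PropositionalEquality using (_≡_)
open import Relation.Binary.Construct.Closure.Transitive using (TransClosure)

ConceptName RoleName IndName : Set
ConceptName = ℕ
RoleName    = ℕ
IndName     = ℕ

data Concept : Set where
  atom : ConceptName → Concept
  top  : Concept
  _⊓_  : Concept → Concept → Concept
  ex   : RoleName → Concept → Concept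

data Axiom : Set where
  _⊑_   : Concept → Concept → Axiom
  cass  : Concept → IndName → Axiom
  rass  : RoleName → IndName → IndName → Axiom

record Interpretation : Set₁ where
  field
    Δ    : Set
    conI : ConceptName → Δ → Set
    rolI : RoleName → Δ → Δ → Set
    indI : IndName → Δ

open Interpretation public

ext : (I : Interpretation) → Concept → Δ I → Set
ext I (atom A) d = conI I A d
ext I top      d = Unit
ext I (C ⊓ D)  d = ext I C d × ext I D d
ext I (ex r C) d = Σ (Δ I) λ e → rolI I r d e × ext I C e

_⊨ₐ_ : Interpretation → Axiom → Set
I ⊨ₐ (C ⊑ D)    = ∀ d → ext I C d → ext I D d
I ⊨ₐ cass C a   = ext I C (indI I a)
I ⊨ₐ rass r a b = rolI I r (indI I a) (indI I b)

-- Finite axiom sets (ontologies) as predicates; we only need singletons.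
-- {β} ⊨ α : every model of {β} satisfies α
_⊨_ : Axiom → Axiom → Set₁
β ⊨ α = (I : Interpretation) → I ⊨ₐ β → I ⊨ₐ α

Con : Axiom → Axiom → Set₁
Con β α = β ⊨ α

_⊊_ : (Axiom → Set₁) → (Axiom → Set₁) → Set₁
P ⊊ Q = (∀ α → P α → Q α) × (∃[ α ] (Q α × ¬ P α))

-- Pre-order (in the paper's sense): irreflexive and transitive
IsPreOrder : Rel Axiom (lsuc lzero) → Set₁
IsPreOrder _≻_ = Irreflexive _≡_ _≻_ × Transitive _≻_

IsWeakening : Rel Axiom (lsuc lzero) → Set₁
IsWeakening _≻_ = IsPreOrder _≻_ × (∀ β γ → β ≻ γ → Con γ ⊊ Con β)

OneStep : Rel Axiom (lsuc lzero) → Rel Axiom (lsuc lzero)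
OneStep _≻_ β γ = β ≻ γ × ¬ (∃[ δ ] (β ≻ δ × δ ≻ γ))

OneStepGenerated : Rel Axiom (lsuc lzero) → Set₁
OneStepGenerated _≻_ =
  ∀ β γ → (β ≻ γ → TransClosure (OneStep _≻_) β γ)
        × (TransClosure (OneStep _≻_) β γ → β ≻ γ)

_≻g_ : Rel Axiom (lsuc lzero)
β ≻g γ = Con γ ⊊ Con β

-- Let ⊤⊑⊤ be the tautology. β ≻g ⊤⊑⊤ holds exactly when β is not valid, and
-- everything A₀ ⊑ A₁ entails is a GCI or a valid assertion (empty A₀ to get a
-- model of A₀ ⊑ A₁; assertions are monotone in the concept names). So a chain of
-- one-steps from A₀ ⊑ A₁ down to ⊤⊑⊤ would end in a one-step C ⊑ D ≻g ⊤⊑⊤ with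
-- C ⊑ D invalid. But C ⊓ A ⊑ D, for a concept name A fresh for C and D, lies
-- strictly between: making A empty or universal shows it neither entails C ⊑ D
-- nor is valid.
module Submission where

open import Defs
open import Data.Empty using (⊥; ⊥-elim)
open import Data.Nat using (zero; suc; _≤_; _<_; _⊔_; s≤s)
open import Data.Nat.Properties using (_≟_; <⇒≢; m≤m⊔n; m≤n⊔m; ≤-trans; ≤-refl)
open import Data.Product using (_×_; _,_; proj₁; proj₂)
open import Data.Unit using (tt) renaming (⊤ to Unit)
open import Function.Base using (id)
open import Relation.Binary.Construct.Closure.Transitive using (TransClosure; [_]; _∷_)
open import Relation.Binary.Definitions using (Irreflexive; Transitive)
open import Relation.Binary.PropositionalEquality using (_≡_; _≢_; refl; sym; subst)
open import Relation.Nullary using (¬_; yes; no)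

Valid : Axiom → Set₁
Valid α = ∀ I → I ⊨ₐ α

⊨-refl : ∀ {β} → β ⊨ β
⊨-refl I I⊨β = I⊨β

⊨-trans : ∀ {β γ δ} → β ⊨ γ → γ ⊨ δ → β ⊨ δ
⊨-trans β⊨γ γ⊨δ I I⊨β = γ⊨δ I (β⊨γ I I⊨β)

⊤⊑⊤ : Axiom
⊤⊑⊤ = top ⊑ top

⊨⊤⊑⊤ : ∀ I → I ⊨ₐ ⊤⊑⊤
⊨⊤⊑⊤ I d _ = tt

≻g-irrefl : Irreflexive _≡_ _≻g_
≻g-irrefl refl (_ , α , β⊨α , β⊭α) = β⊭α β⊨α

≻g-trans : Transitive _≻g_
≻g-trans (γ⊆β , α , β⊨α , γ⊭α) (δ⊆γ , _) =
  (λ α' δ⊨α' → γ⊆β α' (δ⊆γ α' δ⊨α')) , α , β⊨α , λ δ⊨α → γ⊭α (δ⊆γ α δ⊨α)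

≻g-isWeakening : IsWeakening _≻g_
≻g-isWeakening = (≻g-irrefl , λ {β} {γ} {δ} → ≻g-trans {β} {γ} {δ}) , λ _ _ β≻γ → β≻γ

≻g⇒⊨ : ∀ {β γ} → β ≻g γ → β ⊨ γ
≻g⇒⊨ {γ = γ} (γ⊆β , _) = γ⊆β γ (⊨-refl {γ})

≻g-intro : ∀ {β γ} → β ⊨ γ → ¬ (γ ⊨ β) → β ≻g γ
≻g-intro {β} {γ} β⊨γ γ⊭β = (λ α γ⊨α → ⊨-trans {β} {γ} {α} β⊨γ γ⊨α) , β , ⊨-refl {β} , γ⊭β

¬Valid⇒≻g⊤⊑⊤ : ∀ {β} → ¬ Valid β → β ≻g ⊤⊑⊤
¬Valid⇒≻g⊤⊑⊤ {β} ¬valid =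
  ≻g-intro {β} {⊤⊑⊤} (λ I _ → ⊨⊤⊑⊤ I) λ ⊤⊑⊤⊨β → ¬valid λ I → ⊤⊑⊤⊨β I (⊨⊤⊑⊤ I)

≻g⊤⊑⊤⇒¬Valid : ∀ {β} → β ≻g ⊤⊑⊤ → ¬ Valid β
≻g⊤⊑⊤⇒¬Valid (_ , α , β⊨α , ⊤⊑⊤⊭α) valid = ⊤⊑⊤⊭α λ I _ → β⊨α I (valid I)

NamesBelow : ConceptName → Concept → Set
NamesBelow N (atom A) = A < N
NamesBelow N top      = Unit
NamesBelow N (C ⊓ D)  = NamesBelow N C × NamesBelow N D
NamesBelow N (ex r C) = NamesBelow N C

maxName : Concept → ConceptName
maxName (atom A) = A
maxName top      = 0
maxName (C ⊓ D)  = maxName C ⊔ maxName D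
maxName (ex r C) = maxName C

fresh : Concept → ConceptName
fresh C = suc (maxName C)

NamesBelow-mono : ∀ {M N} C → M ≤ N → NamesBelow M C → NamesBelow N C
NamesBelow-mono (atom A) M≤N A<M       = ≤-trans A<M M≤N
NamesBelow-mono top      M≤N _         = tt
NamesBelow-mono (C ⊓ D)  M≤N (bC , bD) = NamesBelow-mono C M≤N bC , NamesBelow-mono D M≤N bD
NamesBelow-mono (ex r C) M≤N bC        = NamesBelow-mono C M≤N bC

NamesBelow-fresh : ∀ C → NamesBelow (fresh C) C
NamesBelow-fresh (atom A) = ≤-refl
NamesBelow-fresh top      = tt
NamesBelow-fresh (C ⊓ D)  =
  NamesBelow-mono C (s≤s (m≤m⊔n (maxName C) (maxName D))) (NamesBelow-fresh C) ,
  NamesBelow-mono D (s≤s (m≤n⊔m (maxName C) (maxName D))) (NamesBelow-fresh D)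
NamesBelow-fresh (ex r C) = NamesBelow-fresh C

withConcepts : (I : Interpretation) → (ConceptName → Δ I → Set) → Interpretation
withConcepts I P = record I { conI = P }

ext-mono : ∀ I N (P Q : ConceptName → Δ I → Set) C → NamesBelow N C →
           (∀ A → A < N → ∀ d → P A d → Q A d) →
           ∀ d → ext (withConcepts I P) C d → ext (withConcepts I Q) C d
ext-mono I N P Q (atom A) A<N P⊆Q d d∈A             = P⊆Q A A<N d d∈A
ext-mono I N P Q top      _   P⊆Q d _               = tt
ext-mono I N P Q (C ⊓ D)  (bC , bD) P⊆Q d (d∈C , d∈D) =
  ext-mono I N P Q C bC P⊆Q d d∈C , ext-mono I N P Q D bD P⊆Q d d∈D
ext-mono I N P Q (ex r C) bC P⊆Q d (e , de∈r , e∈C) = e , de∈r , ext-mono I N P Q C bC P⊆Q e e∈C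

infixl 30 _⟨_≔_⟩

_⟨_≔_⟩ : (I : Interpretation) → ConceptName → (Δ I → Set) → Interpretation
I ⟨ N ≔ S ⟩ = withConcepts I update
  where
  update : ConceptName → Δ I → Set
  update A with A ≟ N
  ... | yes _ = S
  ... | no  _ = conI I A

∅ : {X : Set} → X → Set
∅ _ = ⊥

⟨≔⟩-self : ∀ I N S d → conI (I ⟨ N ≔ S ⟩) N d ≡ S d
⟨≔⟩-self I N S d with N ≟ N
... | yes _  = refl
... | no N≢N = ⊥-elim (N≢N refl)

∉-⟨≔∅⟩ : ∀ I N d → ¬ conI (I ⟨ N ≔ ∅ ⟩) N d
∉-⟨≔∅⟩ I N d = subst id (⟨≔⟩-self I N ∅ d)

⟨≔⟩-other : ∀ I N S A d → A ≢ N → conI (I ⟨ N ≔ S ⟩) A d ≡ conI I A d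
⟨≔⟩-other I N S A d A≢N with A ≟ N
... | yes A≡N = ⊥-elim (A≢N A≡N)
... | no  _   = refl

ext-⟨≔⟩-fresh : ∀ {I N S} C → NamesBelow N C → ∀ d → ext I C d → ext (I ⟨ N ≔ S ⟩) C d
ext-⟨≔⟩-fresh {I} {N} {S} C bC =
  ext-mono I N (conI I) (conI (I ⟨ N ≔ S ⟩)) C bC λ A A<N d →
    subst id (sym (⟨≔⟩-other I N S A d (<⇒≢ A<N)))

ext-⟨≔⟩-fresh⁻ : ∀ {I N S} C → NamesBelow N C → ∀ d → ext (I ⟨ N ≔ S ⟩) C d → ext I C d
ext-⟨≔⟩-fresh⁻ {I} {N} {S} C bC =
  ext-mono I N (conI (I ⟨ N ≔ S ⟩)) (conI I) C bC λ A A<N d →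
    subst id (⟨≔⟩-other I N S A d (<⇒≢ A<N))

⊑-⟨≔⟩-fresh : ∀ {I N S C D} → NamesBelow N C → NamesBelow N D →
              I ⟨ N ≔ S ⟩ ⊨ₐ (C ⊑ D) → I ⊨ₐ (C ⊑ D)
⊑-⟨≔⟩-fresh {C = C} {D} bC bD J⊨C⊑D d d∈C =
  ext-⟨≔⟩-fresh⁻ D bD d (J⊨C⊑D d (ext-⟨≔⟩-fresh C bC d d∈C))

⊑-⊓-left : ∀ {C D E} → (C ⊑ D) ⊨ ((C ⊓ E) ⊑ D)
⊑-⊓-left I I⊨C⊑D d (d∈C , _) = I⊨C⊑D d d∈C

¬OneStep-⊑-⊤⊑⊤ : ∀ {C D} → ¬ OneStep _≻g_ (C ⊑ D) ⊤⊑⊤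
¬OneStep-⊑-⊤⊑⊤ {C} {D} (C⊑D≻⊤⊑⊤ , no-between) =
  no-between ( C⊓A⊑D
             , ≻g-intro {C ⊑ D} {C⊓A⊑D} (⊑-⊓-left {C} {D} {atom N}) C⊓A⊑D⊭C⊑D
             , ¬Valid⇒≻g⊤⊑⊤ {C⊓A⊑D} ¬valid-C⊓A⊑D )
  where
  N = fresh (C ⊓ D)
  C⊓A⊑D = (C ⊓ atom N) ⊑ D
  bC : NamesBelow N C
  bC = proj₁ (NamesBelow-fresh (C ⊓ D))
  bD : NamesBelow N D
  bD = proj₂ (NamesBelow-fresh (C ⊓ D))
  ¬valid : ¬ Valid (C ⊑ D)
  ¬valid = ≻g⊤⊑⊤⇒¬Valid {C ⊑ D} C⊑D≻⊤⊑⊤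

  C⊓A⊑D⊭C⊑D : ¬ (C⊓A⊑D ⊨ (C ⊑ D))
  C⊓A⊑D⊭C⊑D C⊓A⊑D⊨C⊑D = ¬valid λ I → ⊑-⟨≔⟩-fresh {I} {N} {∅} {C} {D} bC bD
    (C⊓A⊑D⊨C⊑D (I ⟨ N ≔ ∅ ⟩) λ d (_ , d∈A) → ⊥-elim (∉-⟨≔∅⟩ I N d d∈A))

  ¬valid-C⊓A⊑D : ¬ Valid C⊓A⊑D
  ¬valid-C⊓A⊑D valid = ¬valid λ I →
    ⊑-⟨≔⟩-fresh {I} {N} {λ _ → Unit} {C} {D} bC bD λ d d∈C → valid (I ⟨ N ≔ (λ _ → Unit) ⟩) d
      (d∈C , subst id (sym (⟨≔⟩-self I N (λ _ → Unit) d)) tt)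

A₀⊑A₁ : Axiom
A₀⊑A₁ = atom 0 ⊑ atom 1

A₀⊑A₁≻g⊤⊑⊤ : A₀⊑A₁ ≻g ⊤⊑⊤
A₀⊑A₁≻g⊤⊑⊤ = ¬Valid⇒≻g⊤⊑⊤ {A₀⊑A₁} λ valid → valid I tt tt
  where
  I : Interpretation
  I = record { Δ = Unit ; conI = λ { zero _ → Unit ; (suc _) _ → ⊥ }
             ; rolI = λ _ _ _ → ⊥ ; indI = λ _ → tt }

⟨≔∅⟩-⊆ : ∀ I N A d → conI (I ⟨ N ≔ ∅ ⟩) A d → conI I A d
⟨≔∅⟩-⊆ I N A d with A ≟ N
... | yes _ = ⊥-elim
... | no  _ = id

⟨0≔∅⟩⊨A₀⊑A₁ : ∀ I → (I ⟨ 0 ≔ ∅ ⟩) ⊨ₐ A₀⊑A₁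
⟨0≔∅⟩⊨A₀⊑A₁ I d d∈A₀ = ⊥-elim (∉-⟨≔∅⟩ I 0 d d∈A₀)

A₀⊑A₁⊨cass⇒Valid : ∀ {C a} → A₀⊑A₁ ⊨ cass C a → Valid (cass C a)
A₀⊑A₁⊨cass⇒Valid {C} {a} A₀⊑A₁⊨Ca I =
  ext-mono I (fresh C) (conI (I ⟨ 0 ≔ ∅ ⟩)) (conI I) C (NamesBelow-fresh C)
    (λ A _ → ⟨≔∅⟩-⊆ I 0 A) (indI I a) (A₀⊑A₁⊨Ca (I ⟨ 0 ≔ ∅ ⟩) (⟨0≔∅⟩⊨A₀⊑A₁ I))

A₀⊑A₁⊨rass⇒Valid : ∀ {r a b} → A₀⊑A₁ ⊨ rass r a b → Valid (rass r a b)
A₀⊑A₁⊨rass⇒Valid A₀⊑A₁⊨rab I = A₀⊑A₁⊨rab (I ⟨ 0 ≔ ∅ ⟩) (⟨0≔∅⟩⊨A₀⊑A₁ I)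

¬OneStep-⊤⊑⊤ : ∀ {β} → A₀⊑A₁ ⊨ β → ¬ OneStep _≻g_ β ⊤⊑⊤
¬OneStep-⊤⊑⊤ {C ⊑ D}      _        = ¬OneStep-⊑-⊤⊑⊤ {C} {D}
¬OneStep-⊤⊑⊤ {cass C a}   A₀⊑A₁⊨β (β≻⊤⊑⊤ , _) =
  ≻g⊤⊑⊤⇒¬Valid {cass C a} β≻⊤⊑⊤ (A₀⊑A₁⊨cass⇒Valid {C} {a} A₀⊑A₁⊨β)
¬OneStep-⊤⊑⊤ {rass r a b} A₀⊑A₁⊨β (β≻⊤⊑⊤ , _) =
  ≻g⊤⊑⊤⇒¬Valid {rass r a b} β≻⊤⊑⊤ (A₀⊑A₁⊨rass⇒Valid {r} {a} {b} A₀⊑A₁⊨β)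

¬OneStep⁺-⊤⊑⊤ : ∀ {β} → A₀⊑A₁ ⊨ β → ¬ TransClosure (OneStep _≻g_) β ⊤⊑⊤
¬OneStep⁺-⊤⊑⊤ {β} A₀⊑A₁⊨β [ step ] = ¬OneStep-⊤⊑⊤ {β} A₀⊑A₁⊨β step
¬OneStep⁺-⊤⊑⊤ {β} A₀⊑A₁⊨β (_∷_ {y = γ} (β≻γ , _) steps) =
  ¬OneStep⁺-⊤⊑⊤ {γ} (⊨-trans {A₀⊑A₁} {β} {γ} A₀⊑A₁⊨β (≻g⇒⊨ {β} {γ} β≻γ)) steps

≻g-¬oneStepGenerated : ¬ OneStepGenerated _≻g_
≻g-¬oneStepGenerated generated =
  ¬OneStep⁺-⊤⊑⊤ {A₀⊑A₁} (⊨-refl {A₀⊑A₁}) (proj₁ (generated A₀⊑A₁ ⊤⊑⊤) A₀⊑A₁≻g⊤⊑⊤)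

proposition17 : IsWeakening _≻g_ × ¬ OneStepGenerated _≻g_
proposition17 = ≻g-isWeakening , ≻g-¬oneStepGenerated
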